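{- Let $(P_n)_{n\ge0}$ and $(Q_n)_{n\ge0}$ be the sequences of polynomials in $m$ defined by $P_0=Q_0=0$, $P_1(m)=Q_1(m)=m$, and for $n\ge 1$: $Q_{n+1}(m)=\sum_{k=0}^{n}Q_{n-k}(m)\,P_k(m)$ and $P_{n+1}(m)=P_n(m+1)+Q_{n+1}(m)$. For $q\ge0$ let $\varphi_{2q+1}$ be the second leading coefficient of $P_{2q+1}$, i.e. the coefficient of $m^{q}$ in $P_{2q+1}$. Then $\varphi_1=0$, $\varphi_3=1$, and for every $q\ge 0$, $\varphi_{2q+5}=(q+3)\binom{2q+1}{q}$.
   Context: $P_n(m)$ counts beta-normal untyped lambda terms of size $n$ with de Bruijn indices in $\{1,\dots,m\}$, and $Q_n(m)$ counts those not starting with a $\lambda$. -}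

module Defs where

open import Data.Nat using (ℕ; zero; suc; _+_; _*_)
open import Data.List using (List; []; _∷_; map; reverse; zipWith; foldr)
open import Data.Product using (_×_; _,_; proj₁; proj₂)

-- Univariate polynomials in m with natural-number coefficients,
-- represented as coefficient lists in ascending degree order
-- (index i = coefficient of m^i). Trailing zeros are allowed.
Poly : Set
Poly = List ℕ

_⊕_ : Poly → Poly → Poly
[] ⊕ q = q
(a ∷ p) ⊕ [] = a ∷ p
(a ∷ p) ⊕ (b ∷ q) = (a + b) ∷ (p ⊕ q)

scale : ℕ → Poly → Poly
scale c = map (c *_)

_⊗_ : Poly → Poly → Poly
[] ⊗ q = []
(a ∷ p) ⊗ q = scale a q ⊕ (0 ∷ (p ⊗ q))

polySum : List Poly → Poly
polySum = foldr _⊕_ []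

timesMPlus1 : Poly → Poly
timesMPlus1 r = r ⊕ (0 ∷ r)

-- shift p : the polynomial m ↦ p(m + 1)   (Horner scheme)
shift : Poly → Poly
shift [] = []
shift (a ∷ p) = (a ∷ []) ⊕ timesMPlus1 (shift p)

coeff : Poly → ℕ → ℕ
coeff [] i = 0
coeff (a ∷ p) zero = a
coeff (a ∷ p) (suc i) = coeff p i

monoM : Poly
monoM = 0 ∷ 1 ∷ []

-- Given the history [(P_n,Q_n), …, (P_0,Q_0)] (n ≥ 1), prepend (P_{n+1},Q_{n+1}) where
--   Q_{n+1} = Σ_{k=0}^{n} Q_{n-k} P_k ,   P_{n+1} = P_n(m+1) + Q_{n+1}.
next : List (Poly × Poly) → List (Poly × Poly)
next [] = []
next h@((p , _) ∷ _) =
  let qs = map proj₂ h            -- Q_n, …, Q_0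
      ps = reverse (map proj₁ h)  -- P_0, …, P_n
      qNew = polySum (zipWith _⊗_ qs ps)
  in (shift p ⊕ qNew , qNew) ∷ h

-- hist n = [(P_n,Q_n), …, (P_0,Q_0)]
hist : ℕ → List (Poly × Poly)
hist zero = ([] , []) ∷ []
hist (suc zero) = (monoM , monoM) ∷ hist zero
hist (suc (suc n)) = next (hist (suc n))

headP : List (Poly × Poly) → Poly
headP [] = []
headP ((p , _) ∷ _) = p

headQ : List (Poly × Poly) → Poly
headQ [] = []
headQ ((_ , q) ∷ _) = q

P : ℕ → Poly
P n = headP (hist n)

Q : ℕ → Poly
Q n = headQ (hist n)

-- φ_{2q+1} : the coefficient of m^q in P_{2q+1}
φ : ℕ → ℕ
φ q = coeff (P (suc (2 * q))) q

module Submission where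

-- Since 2·deg Pₙ ≤ n + 1 and 2·deg Qₙ ≤ n + 1, the coefficient arrays of Pₙ and Qₙ can be read
-- along diagonals: gP d = Σₙ ([m^i] Pₙ)·xⁿ summed over 2i + d = n + 1, and likewise gQ d.  Then
-- φ_q is the coefficient of x^(2q+1) in gP 2.  The development is:
--  (1) series ℕ → ℕ form a commutative semiring (so the ring solver applies to them); series with
--      constant term 1 cancel, Z = c + x·W·Z has at most one solution, and θ = x·d/dx is a derivation;
--  (2) the reversal rev turns a polynomial in m into its diagonal series and is multiplicative
--      on polynomials of bounded degree;
--  (3) the recurrences of Pₙ, Qₙ are read off from hist, and give the degree bounds above;
--  (4) hence the diagonals d = 0, 1, 2 satisfy algebraic equations, e.g. A = x(1 + A²) for A = gQ 0;
--  (5) solving them: with T = gP 1 / x² one finds T² = 1/(1 - 4x²), gP 2 = x³T + x⁵T³ and θT = 4x²T³,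
--      so (n+2)·T_{n+2} = 4(n+1)·T_n and 4·[x^(2q)]T³ = (2q+2)·T_{2q+2};
--  (6) with binomial identities, T_{2q+2} = 2·C(2q+1, q), and φ_{q+2} = (q+3)·C(2q+1, q) follows.

open import Defs
open import Data.Nat using (ℕ; zero; suc; _+_; _*_; _∸_; _≤_; _<_; z≤n; s≤s; NonZero)
open import Data.Nat.Properties
open import Data.Nat.Induction using (<-rec)
open import Data.Nat.Solver using (module +-*-Solver)
open import Data.Nat.ListAction using (sum)
open import Data.Nat.Combinatorics using (_C_; nC1≡n; nCk≡nC[n∸k]; nCk+nC[k+1]≡[n+1]C[k+1])
open import Data.Product using (_×_; _,_; proj₁; proj₂)
open import Data.Maybe using (nothing)
open import Data.List using ([]; _∷_; map; reverse; zipWith; applyUpTo; applyDownFrom)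
open import Data.List.Properties using (reverse-applyDownFrom)
open import Relation.Binary.PropositionalEquality using (_≡_; refl; sym; trans; cong; cong₂; subst; module ≡-Reasoning)
open import Relation.Binary.Structures using (IsEquivalence)
import Relation.Binary.Reasoning.Setoid
open import Algebra.Bundles using (CommutativeSemiring)
open import Algebra.Structures using (IsCommutativeMonoid)
open import Algebra.Structures.Biased using (IsCommutativeSemiringˡ)
import Algebra.Solver.Ring.NaturalCoefficients
open import Algebra.Properties.CommutativeSemigroup +-commutativeSemigroup
  using () renaming (interchange to +-interchange)
open import Algebra.Properties.CommutativeSemigroup *-commutativeSemigroup
  using () renaming (x∙yz≈y∙xz to *-leftComm)

Ser : Set
Ser = ℕ → ℕ

infix 4 _≋_
_≋_ : Ser → Ser → Set
a ≋ b = ∀ n → a n ≡ b n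

infixl 6 _⊞_
infixl 7 _⊠_

_⊞_ : Ser → Ser → Ser
(a ⊞ b) n = a n + b n

0ˢ : Ser
0ˢ _ = 0

1ˢ : Ser
1ˢ zero = 1
1ˢ (suc n) = 0

tl : Ser → Ser
tl a n = a (suc n)

_⊠_ : Ser → Ser → Ser
(a ⊠ b) zero = a 0 * b 0
(a ⊠ b) (suc n) = a 0 * b (suc n) + (tl a ⊠ b) n

scaleˢ : ℕ → Ser → Ser
scaleˢ c a n = c * a n

mulX : Ser → Ser
mulX a zero = 0
mulX a (suc n) = a n

⊠-cong : ∀ {a a' b b'} → a ≋ a' → b ≋ b' → a ⊠ b ≋ a' ⊠ b'
⊠-cong p q zero = cong₂ _*_ (p 0) (q 0)
⊠-cong p q (suc n) = cong₂ _+_ (cong₂ _*_ (p 0) (q (suc n))) (⊠-cong (λ i → p (suc i)) q n)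

⊠-cong-below : ∀ a {b b'} n → (∀ k → k ≤ n → b k ≡ b' k) → (a ⊠ b) n ≡ (a ⊠ b') n
⊠-cong-below a zero h = cong (a 0 *_) (h 0 z≤n)
⊠-cong-below a (suc n) h =
  cong₂ _+_ (cong (a 0 *_) (h (suc n) ≤-refl)) (⊠-cong-below (tl a) n (λ k k≤n → h k (m≤n⇒m≤1+n k≤n)))

⊠-zeroˡ : ∀ b → 0ˢ ⊠ b ≋ 0ˢ
⊠-zeroˡ b zero = refl
⊠-zeroˡ b (suc n) = ⊠-zeroˡ b n

⊠-identityˡ : ∀ b → 1ˢ ⊠ b ≋ b
⊠-identityˡ b zero = +-identityʳ (b 0)
⊠-identityˡ b (suc n) = trans (cong₂ _+_ (+-identityʳ (b (suc n))) (⊠-zeroˡ b n)) (+-identityʳ _)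

⊠-identityʳ : ∀ a → a ⊠ 1ˢ ≋ a
⊠-identityʳ a zero = *-identityʳ (a 0)
⊠-identityʳ a (suc n) = trans (cong (_+ (tl a ⊠ 1ˢ) n) (*-zeroʳ (a 0))) (⊠-identityʳ (tl a) n)

⊠-distribʳ : ∀ a a' b → (a ⊞ a') ⊠ b ≋ a ⊠ b ⊞ a' ⊠ b
⊠-distribʳ a a' b zero = *-distribʳ-+ (b 0) (a 0) (a' 0)
⊠-distribʳ a a' b (suc n) =
  trans (cong₂ _+_ (*-distribʳ-+ (b (suc n)) (a 0) (a' 0)) (⊠-distribʳ (tl a) (tl a') b n))
    (+-interchange (a 0 * b (suc n)) (a' 0 * b (suc n)) ((tl a ⊠ b) n) ((tl a' ⊠ b) n))

⊠-distribˡ : ∀ a b b' → a ⊠ (b ⊞ b') ≋ a ⊠ b ⊞ a ⊠ b'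
⊠-distribˡ a b b' zero = *-distribˡ-+ (a 0) (b 0) (b' 0)
⊠-distribˡ a b b' (suc n) =
  trans (cong₂ _+_ (*-distribˡ-+ (a 0) (b (suc n)) (b' (suc n))) (⊠-distribˡ (tl a) b b' n))
    (+-interchange (a 0 * b (suc n)) (a 0 * b' (suc n)) ((tl a ⊠ b) n) ((tl a ⊠ b') n))

⊠-scaleˡ : ∀ c a b → scaleˢ c a ⊠ b ≋ scaleˢ c (a ⊠ b)
⊠-scaleˡ c a b zero = *-assoc c (a 0) (b 0)
⊠-scaleˡ c a b (suc n) =
  trans (cong₂ _+_ (*-assoc c (a 0) (b (suc n))) (⊠-scaleˡ c (tl a) b n)) (sym (*-distribˡ-+ c _ _))

⊠-scaleʳ : ∀ c a b → a ⊠ scaleˢ c b ≋ scaleˢ c (a ⊠ b)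
⊠-scaleʳ c a b zero = *-leftComm (a 0) c (b 0)
⊠-scaleʳ c a b (suc n) =
  trans (cong₂ _+_ (*-leftComm (a 0) c (b (suc n))) (⊠-scaleʳ c (tl a) b n)) (sym (*-distribˡ-+ c _ _))

⊠-mulXʳ : ∀ a b → a ⊠ mulX b ≋ mulX (a ⊠ b)
⊠-mulXʳ a b zero = *-zeroʳ (a 0)
⊠-mulXʳ a b (suc zero) = trans (cong (a 0 * b 0 +_) (*-zeroʳ (a 1))) (+-identityʳ _)
⊠-mulXʳ a b (suc (suc n)) = cong (a 0 * b (suc n) +_) (⊠-mulXʳ (tl a) b (suc n))

split : ∀ b → b ≋ scaleˢ (b 0) 1ˢ ⊞ mulX (tl b)
split b zero = sym (trans (+-identityʳ _) (*-identityʳ (b 0)))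
split b (suc n) = sym (cong (_+ b (suc n)) (*-zeroʳ (b 0)))

-- commutativity: split off the constant term of b and recurse on its tail
⊠-comm : ∀ a b → a ⊠ b ≋ b ⊠ a
⊠-comm a b zero = *-comm (a 0) (b 0)
⊠-comm a b (suc n) = begin
  (a ⊠ b) (suc n)                                          ≡⟨ ⊠-cong {a} (λ _ → refl) (split b) (suc n) ⟩
  (a ⊠ (scaleˢ (b 0) 1ˢ ⊞ mulX (tl b))) (suc n)            ≡⟨ ⊠-distribˡ a _ _ (suc n) ⟩
  (a ⊠ scaleˢ (b 0) 1ˢ) (suc n) + (a ⊠ mulX (tl b)) (suc n) ≡⟨ cong₂ _+_ constant-part (⊠-mulXʳ a (tl b) (suc n)) ⟩
  b 0 * a (suc n) + (a ⊠ tl b) n                           ≡⟨ cong (b 0 * a (suc n) +_) (⊠-comm a (tl b) n) ⟩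
  (b ⊠ a) (suc n)                                          ∎
  where
  open ≡-Reasoning
  constant-part : (a ⊠ scaleˢ (b 0) 1ˢ) (suc n) ≡ b 0 * a (suc n)
  constant-part = trans (⊠-scaleʳ (b 0) a 1ˢ (suc n)) (cong (b 0 *_) (⊠-identityʳ a (suc n)))

-- associativity: the tail of a ⊠ b is a₀·tl b + tl a ⊠ b
⊠-assoc : ∀ a b c → (a ⊠ b) ⊠ c ≋ a ⊠ (b ⊠ c)
⊠-assoc a b c zero = *-assoc (a 0) (b 0) (c 0)
⊠-assoc a b c (suc n) = begin
  (a 0 * b 0) * c (suc n) + (tl (a ⊠ b) ⊠ c) n
    ≡⟨ cong₂ _+_ (*-assoc (a 0) (b 0) (c (suc n))) (⊠-distribʳ (scaleˢ (a 0) (tl b)) (tl a ⊠ b) c n) ⟩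
  a 0 * (b 0 * c (suc n)) + ((scaleˢ (a 0) (tl b) ⊠ c) n + ((tl a ⊠ b) ⊠ c) n)
    ≡⟨ cong (a 0 * (b 0 * c (suc n)) +_) (cong₂ _+_ (⊠-scaleˡ (a 0) (tl b) c n) (⊠-assoc (tl a) b c n)) ⟩
  a 0 * (b 0 * c (suc n)) + (a 0 * (tl b ⊠ c) n + (tl a ⊠ (b ⊠ c)) n)
    ≡⟨ sym (+-assoc (a 0 * (b 0 * c (suc n))) _ _) ⟩
  (a 0 * (b 0 * c (suc n)) + a 0 * (tl b ⊠ c) n) + (tl a ⊠ (b ⊠ c)) n
    ≡⟨ cong (_+ (tl a ⊠ (b ⊠ c)) n) (sym (*-distribˡ-+ (a 0) _ _)) ⟩
  a 0 * (b ⊠ c) (suc n) + (tl a ⊠ (b ⊠ c)) n ∎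
  where open ≡-Reasoning

≋-refl : ∀ {a} → a ≋ a
≋-refl n = refl

≋-sym : ∀ {a b} → a ≋ b → b ≋ a
≋-sym p n = sym (p n)

≋-trans : ∀ {a b c} → a ≋ b → b ≋ c → a ≋ c
≋-trans p q n = trans (p n) (q n)

⊞-cong : ∀ {a a' b b'} → a ≋ a' → b ≋ b' → a ⊞ b ≋ a' ⊞ b'
⊞-cong p q n = cong₂ _+_ (p n) (q n)

scale-cong : ∀ c {a b} → a ≋ b → scaleˢ c a ≋ scaleˢ c b
scale-cong c p n = cong (c *_) (p n)

-- Series form a commutative semiring; this makes the ring solver available for them.
seriesSemiring : CommutativeSemiring _ _
seriesSemiring = record
  { Carrier = Ser ; _≈_ = _≋_ ; _+_ = _⊞_ ; _*_ = _⊠_ ; 0# = 0ˢ ; 1# = 1ˢ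
  ; isCommutativeSemiring = IsCommutativeSemiringˡ.isCommutativeSemiring (record
    { +-isCommutativeMonoid = +-isCommutativeMonoid
    ; *-isCommutativeMonoid = *-isCommutativeMonoid
    ; distribʳ = λ c a b → ⊠-distribʳ a b c
    ; zeroˡ = ⊠-zeroˡ }) }
  where
  isEquivalence : IsEquivalence _≋_
  isEquivalence = record { refl = ≋-refl ; sym = ≋-sym ; trans = ≋-trans }
  +-isCommutativeMonoid : IsCommutativeMonoid _≋_ _⊞_ 0ˢ
  +-isCommutativeMonoid = record
    { isMonoid = record
      { isSemigroup = record
        { isMagma = record { isEquivalence = isEquivalence ; ∙-cong = ⊞-cong }
        ; assoc = λ a b c n → +-assoc (a n) (b n) (c n) }
      ; identity = (λ a n → refl) , (λ a n → +-identityʳ (a n)) }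
    ; comm = λ a b n → +-comm (a n) (b n) }
  *-isCommutativeMonoid : IsCommutativeMonoid _≋_ _⊠_ 1ˢ
  *-isCommutativeMonoid = record
    { isMonoid = record
      { isSemigroup = record
        { isMagma = record { isEquivalence = isEquivalence ; ∙-cong = ⊠-cong }
        ; assoc = ⊠-assoc }
      ; identity = ⊠-identityˡ , ⊠-identityʳ }
    ; comm = ⊠-comm }

module ≋-Reasoning = Relation.Binary.Reasoning.Setoid (CommutativeSemiring.setoid seriesSemiring)

X : Ser
X (suc zero) = 1
X _ = 0

infixr 8 _^_
_^_ : Ser → ℕ → Ser
a ^ zero = 1ˢ
a ^ suc k = a ⊠ a ^ k

-- the constant series c, written as the solver writes the numeral c
open import Algebra.Properties.Semiring.Mult.TCOptimised (CommutativeSemiring.semiring seriesSemiring)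
  using () renaming (_×_ to _×ˢ_)

κ : ℕ → Ser
κ c = c ×ˢ 1ˢ

κ⊠ : ∀ c a → κ c ⊠ a ≋ scaleˢ c a
κ⊠ zero a n = ⊠-zeroˡ a n
κ⊠ (suc zero) a n = trans (⊠-identityˡ a n) (sym (*-identityˡ (a n)))
κ⊠ (suc (suc c)) a n = trans (⊠-distribʳ (κ (suc c)) 1ˢ a n)
  (trans (cong₂ _+_ (κ⊠ (suc c) a n) (⊠-identityˡ a n)) (+-comm (suc c * a n) (a n)))

mulX≋X⊠ : ∀ a → mulX a ≋ X ⊠ a
mulX≋X⊠ a zero = refl
mulX≋X⊠ a (suc n) = sym (trans (⊠-cong tl-X (λ _ → refl) n) (⊠-identityˡ a n))
  where
  tl-X : tl X ≋ 1ˢ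
  tl-X zero = refl
  tl-X (suc n) = refl

X⊠-suc : ∀ a n → (X ⊠ a) (suc n) ≡ a n
X⊠-suc a n = sym (mulX≋X⊠ a (suc n))

X^⊠-coeff : ∀ k a n → (X ^ k ⊠ a) (k + n) ≡ a n
X^⊠-coeff zero a n = ⊠-identityˡ a n
X^⊠-coeff (suc k) a n = begin
  (X ⊠ X ^ k ⊠ a) (suc (k + n))     ≡⟨ ⊠-assoc X (X ^ k) a (suc (k + n)) ⟩
  (X ⊠ (X ^ k ⊠ a)) (suc (k + n))   ≡⟨ X⊠-suc (X ^ k ⊠ a) (k + n) ⟩
  (X ^ k ⊠ a) (k + n)               ≡⟨ X^⊠-coeff k a n ⟩
  a n                               ∎
  where open ≡-Reasoning

X-cancel : ∀ {a b} → X ⊠ a ≋ X ⊠ b → a ≋ b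
X-cancel {a} {b} e n = trans (sym (X⊠-suc a n)) (trans (e (suc n)) (X⊠-suc b n))

κ-cancel : ∀ c .{{_ : NonZero c}} {a b} → κ c ⊠ a ≋ κ c ⊠ b → a ≋ b
κ-cancel c {a} {b} e n = *-cancelˡ-≡ (a n) (b n) c (trans (sym (κ⊠ c a n)) (trans (e n) (κ⊠ c b n)))

⊞-cancelˡ : ∀ a {b c} → a ⊞ b ≋ a ⊞ c → b ≋ c
⊞-cancelˡ a e n = +-cancelˡ-≡ (a n) _ _ (e n)

≋-by-recursion : ∀ {a b} → (∀ n → (∀ k → k < n → a k ≡ b k) → a n ≡ b n) → a ≋ b
≋-by-recursion {a} {b} step = <-rec (λ n → a n ≡ b n) (λ n ih → step n (λ k k<n → ih k<n))

unit-cancel : ∀ t {a b} → t 0 ≡ 1 → t ⊠ a ≋ t ⊠ b → a ≋ b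
unit-cancel t {a} {b} t₀≡1 e = ≋-by-recursion step
  where
  cancel-t₀ : ∀ {u v} → t 0 * u ≡ t 0 * v → u ≡ v
  cancel-t₀ {u} {v} p rewrite t₀≡1 = trans (sym (*-identityˡ u)) (trans p (*-identityˡ v))
  step : ∀ n → (∀ k → k < n → a k ≡ b k) → a n ≡ b n
  step zero _ = cancel-t₀ (e 0)
  step (suc n) ih = cancel-t₀ (+-cancelʳ-≡ _ _ _ (trans (e (suc n))
    (cong (t 0 * b (suc n) +_) (⊠-cong-below (tl t) n (λ k k≤n → sym (ih k (s≤s k≤n)))))))

unique-solution : ∀ c W {Z Z'} → Z ≋ c ⊞ X ⊠ W ⊠ Z → Z' ≋ c ⊞ X ⊠ W ⊠ Z' → Z ≋ Z'
unique-solution c W {Z} {Z'} e e' = ≋-by-recursion step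
  where
  next-coeff : ∀ {Y} → Y ≋ c ⊞ X ⊠ W ⊠ Y → ∀ n → Y (suc n) ≡ c (suc n) + (W ⊠ Y) n
  next-coeff {Y} eY n = trans (eY (suc n)) (cong (c (suc n) +_) (trans (⊠-assoc X W Y (suc n)) (X⊠-suc (W ⊠ Y) n)))
  step : ∀ n → (∀ k → k < n → Z k ≡ Z' k) → Z n ≡ Z' n
  step zero _ = trans (e 0) (sym (e' 0))
  step (suc n) ih = trans (next-coeff e n)
    (trans (cong (c (suc n) +_) (⊠-cong-below W n (λ k k≤n → ih k (s≤s k≤n)))) (sym (next-coeff e' n)))

-- The Euler operator θ = x·d/dx, a derivation of the series semiring

θ : Ser → Ser
θ a n = n * a n

θ-cong : ∀ {a b} → a ≋ b → θ a ≋ θ b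
θ-cong e n = cong (n *_) (e n)

θ-⊞ : ∀ a b → θ (a ⊞ b) ≋ θ a ⊞ θ b
θ-⊞ a b n = *-distribˡ-+ n (a n) (b n)

θ-κ : ∀ c → θ (κ c) ≋ 0ˢ
θ-κ c zero = refl
θ-κ c (suc n) = trans (cong (suc n *_) κ-suc) (*-zeroʳ (suc n))
  where
  κ-suc : κ c (suc n) ≡ 0
  κ-suc = trans (sym (⊠-identityʳ (κ c) (suc n))) (trans (κ⊠ c 1ˢ (suc n)) (*-zeroʳ c))

θ-X : θ X ≋ X
θ-X zero = refl
θ-X (suc zero) = refl
θ-X (suc (suc n)) = *-zeroʳ (suc (suc n))

-- Leibniz rule with an offset: (s + n)·(c ⊠ b)ₙ = ((s + i)·cᵢ ⊠ b)ₙ + (c ⊠ θb)ₙ.  The offset s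
-- records the index shift when the recursion passes from c to tl c; s = 0 is the Leibniz rule.
θ-⊠-offset : ∀ s c b n → (s + n) * (c ⊠ b) n ≡ ((λ i → (s + i) * c i) ⊠ b) n + (c ⊠ θ b) n
θ-⊠-offset s c b zero = solve 3 (λ s x y → (s :+ con 0) :* (x :* y) := (s :+ con 0) :* x :* y :+ x :* (con 0 :* y))
  refl s (c 0) (b 0)
  where open +-*-Solver
θ-⊠-offset s c b (suc n) = begin
  (s + suc n) * (c 0 * b (suc n) + (tl c ⊠ b) n)
    ≡⟨ solve 5 (λ s n x y m → (s :+ (con 1 :+ n)) :* (x :* y :+ m)
                             := ((s :+ con 0) :* x :* y :+ (con 1 :+ s :+ n) :* m) :+ x :* ((con 1 :+ n) :* y))
         refl s n (c 0) (b (suc n)) ((tl c ⊠ b) n) ⟩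
  ((s + 0) * c 0 * b (suc n) + (suc s + n) * (tl c ⊠ b) n) + c 0 * (suc n * b (suc n))
    ≡⟨ cong (λ z → ((s + 0) * c 0 * b (suc n) + z) + c 0 * (suc n * b (suc n))) (θ-⊠-offset (suc s) (tl c) b n) ⟩
  ((s + 0) * c 0 * b (suc n) + (((λ i → (suc s + i) * c (suc i)) ⊠ b) n + (tl c ⊠ θ b) n)) + c 0 * (suc n * b (suc n))
    ≡⟨ cong (λ z → ((s + 0) * c 0 * b (suc n) + (z + (tl c ⊠ θ b) n)) + c 0 * (suc n * b (suc n)))
         (⊠-cong (λ i → cong (_* c (suc i)) (sym (+-suc s i))) (λ _ → refl) n) ⟩
  ((s + 0) * c 0 * b (suc n) + (((λ i → (s + suc i) * c (suc i)) ⊠ b) n + (tl c ⊠ θ b) n)) + c 0 * (suc n * b (suc n))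
    ≡⟨ solve 4 (λ p q r t → (p :+ (q :+ r)) :+ t := (p :+ q) :+ (t :+ r)) refl
         ((s + 0) * c 0 * b (suc n)) (((λ i → (s + suc i) * c (suc i)) ⊠ b) n) ((tl c ⊠ θ b) n) (c 0 * (suc n * b (suc n))) ⟩
  ((λ i → (s + i) * c i) ⊠ b) (suc n) + (c ⊠ θ b) (suc n) ∎
  where
  open ≡-Reasoning
  open +-*-Solver

θ-⊠ : ∀ a b → θ (a ⊠ b) ≋ θ a ⊠ b ⊞ a ⊠ θ b
θ-⊠ = θ-⊠-offset 0

θ-X⊠ : ∀ S → θ (X ⊠ S) ≋ X ⊠ (S ⊞ θ S)
θ-X⊠ S n = begin
  θ (X ⊠ S) n                    ≡⟨ θ-⊠ X S n ⟩
  (θ X ⊠ S) n + (X ⊠ θ S) n      ≡⟨ cong (_+ (X ⊠ θ S) n) (⊠-cong θ-X (λ _ → refl) n) ⟩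
  (X ⊠ S) n + (X ⊠ θ S) n        ≡⟨ sym (⊠-distribˡ X S (θ S) n) ⟩
  (X ⊠ (S ⊞ θ S)) n              ∎
  where open ≡-Reasoning

θ-κ⊠ : ∀ c S → θ (κ c ⊠ S) ≋ κ c ⊠ θ S
θ-κ⊠ c S n = trans (θ-⊠ (κ c) S n) (cong (_+ (κ c ⊠ θ S) n) (trans (⊠-cong (θ-κ c) (λ _ → refl) n) (⊠-zeroˡ S n)))

-- mono k c = c·xᵏ, by a recursion that computes on concrete indices
mono : ℕ → ℕ → Ser
mono zero c zero = c
mono zero c (suc r) = 0
mono (suc k) c zero = 0
mono (suc k) c (suc r) = mono k c r

-- rev N a = Σ_{2i ≤ N} aᵢ·x^(N-2i).  If a is the coefficient sequence of a polynomial p(m)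
-- with 2·deg p ≤ N, the coefficient of x^d in rev N a is the coefficient of m^((N-d)/2) in p.
rev : ℕ → Ser → Ser
rev zero a = mono 0 (a 0)
rev (suc zero) a = mono 1 (a 0)
rev (suc (suc N)) a = mono (suc (suc N)) (a 0) ⊞ rev N (tl a)

TwiceDeg≤ : ℕ → Ser → Set
TwiceDeg≤ J a = ∀ i → J < 2 * i → a i ≡ 0

mono-0 : ∀ k → mono k 0 ≋ 0ˢ
mono-0 zero zero = refl
mono-0 zero (suc r) = refl
mono-0 (suc k) zero = refl
mono-0 (suc k) (suc r) = mono-0 k r

mono-+ : ∀ k x y → mono k (x + y) ≋ mono k x ⊞ mono k y
mono-+ zero x y zero = refl
mono-+ zero x y (suc r) = refl
mono-+ (suc k) x y zero = refl
mono-+ (suc k) x y (suc r) = mono-+ k x y r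

mono-* : ∀ k c x → mono k (c * x) ≋ scaleˢ c (mono k x)
mono-* zero c x zero = refl
mono-* zero c x (suc r) = sym (*-zeroʳ c)
mono-* (suc k) c x zero = sym (*-zeroʳ c)
mono-* (suc k) c x (suc r) = mono-* k c x r

mono≋ : ∀ k c → mono k c ≋ scaleˢ c (X ^ k)
mono≋ zero c zero = sym (*-identityʳ c)
mono≋ zero c (suc r) = sym (*-zeroʳ c)
mono≋ (suc k) c zero = sym (*-zeroʳ c)
mono≋ (suc k) c (suc r) = begin
  mono k c r                   ≡⟨ mono≋ k c r ⟩
  c * (X ^ k) r                ≡⟨ cong (c *_) (sym (X⊠-suc (X ^ k) r)) ⟩
  c * (X ^ suc k) (suc r)      ∎
  where open ≡-Reasoning

X^-+ : ∀ M k → X ^ (M + k) ≋ X ^ M ⊠ X ^ k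
X^-+ zero k n = sym (⊠-identityˡ (X ^ k) n)
X^-+ (suc M) k n = trans (⊠-cong {X} (λ _ → refl) (X^-+ M k) n) (sym (⊠-assoc X (X ^ M) (X ^ k) n))

X^⊠-mono : ∀ M k c → X ^ M ⊠ mono k c ≋ mono (M + k) c
X^⊠-mono M k c n = begin
  (X ^ M ⊠ mono k c) n             ≡⟨ ⊠-cong {X ^ M} (λ _ → refl) (mono≋ k c) n ⟩
  (X ^ M ⊠ scaleˢ c (X ^ k)) n     ≡⟨ ⊠-scaleʳ c (X ^ M) (X ^ k) n ⟩
  c * (X ^ M ⊠ X ^ k) n            ≡⟨ cong (c *_) (sym (X^-+ M k n)) ⟩
  c * (X ^ (M + k)) n              ≡⟨ sym (mono≋ (M + k) c n) ⟩
  mono (M + k) c n                 ∎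
  where open ≡-Reasoning

mono⊠ : ∀ k c e → mono k c ⊠ e ≋ scaleˢ c (X ^ k ⊠ e)
mono⊠ k c e n = trans (⊠-cong (mono≋ k c) (λ _ → refl) n) (⊠-scaleˡ c (X ^ k) e n)

rev-cong : ∀ N {a b} → a ≋ b → rev N a ≋ rev N b
rev-cong zero e r = cong (λ z → mono 0 z r) (e 0)
rev-cong (suc zero) e r = cong (λ z → mono 1 z r) (e 0)
rev-cong (suc (suc N)) e r = cong₂ _+_ (cong (λ z → mono (suc (suc N)) z r) (e 0)) (rev-cong N (λ i → e (suc i)) r)

rev-0 : ∀ N → rev N 0ˢ ≋ 0ˢ
rev-0 zero = mono-0 0
rev-0 (suc zero) = mono-0 1
rev-0 (suc (suc N)) r = cong₂ _+_ (mono-0 (suc (suc N)) r) (rev-0 N r)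

rev-⊞ : ∀ N a b → rev N (a ⊞ b) ≋ rev N a ⊞ rev N b
rev-⊞ zero a b = mono-+ 0 (a 0) (b 0)
rev-⊞ (suc zero) a b = mono-+ 1 (a 0) (b 0)
rev-⊞ (suc (suc N)) a b r = trans (cong₂ _+_ (mono-+ (suc (suc N)) (a 0) (b 0) r) (rev-⊞ N (tl a) (tl b) r))
  (+-interchange (mono (suc (suc N)) (a 0) r) (mono (suc (suc N)) (b 0) r) (rev N (tl a) r) (rev N (tl b) r))

rev-scale : ∀ N c a → rev N (scaleˢ c a) ≋ scaleˢ c (rev N a)
rev-scale zero c a = mono-* 0 c (a 0)
rev-scale (suc zero) c a = mono-* 1 c (a 0)
rev-scale (suc (suc N)) c a r =
  trans (cong₂ _+_ (mono-* (suc (suc N)) c (a 0) r) (rev-scale N c (tl a) r)) (sym (*-distribˡ-+ c _ _))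

rev-mulX : ∀ N a → rev (suc (suc N)) (mulX a) ≋ rev N a
rev-mulX N a r = cong (_+ rev N a r) (mono-0 (suc (suc N)) r)

rev-idx : ∀ {N N'} a → N ≡ N' → rev N a ≋ rev N' a
rev-idx a refl r = refl

TwiceDeg≤-tl : ∀ J a → TwiceDeg≤ (suc (suc J)) a → TwiceDeg≤ J (tl a)
TwiceDeg≤-tl J a h i J<2i = h (suc i) (subst (suc (suc J) <_) (sym (*-suc 2 i)) (s≤s (s≤s J<2i)))

TwiceDeg≤1⇒const : ∀ J a → J ≤ 1 → TwiceDeg≤ J a → tl a ≋ 0ˢ
TwiceDeg≤1⇒const J a J≤1 h i = h (suc i) (subst (J <_) (sym (*-suc 2 i)) (s≤s (≤-trans J≤1 (s≤s z≤n))))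

rev-const : ∀ N a → tl a ≋ 0ˢ → rev N a ≋ mono N (a 0)
rev-const zero a h r = refl
rev-const (suc zero) a h r = refl
rev-const (suc (suc N)) a h r =
  trans (cong (mono (suc (suc N)) (a 0) r +_) (trans (rev-cong N h r) (rev-0 N r))) (+-identityʳ _)

⊠-const : ∀ a b → tl a ≋ 0ˢ → a ⊠ b ≋ scaleˢ (a 0) b
⊠-const a b h zero = refl
⊠-const a b h (suc n) = trans (cong (a 0 * b (suc n) +_) (trans (⊠-cong h (λ _ → refl) n) (⊠-zeroˡ b n))) (+-identityʳ _)

⊠-split : ∀ a b → a ⊠ b ≋ scaleˢ (a 0) b ⊞ mulX (tl a ⊠ b)
⊠-split a b zero = sym (+-identityʳ _)
⊠-split a b (suc n) = refl

rev-+ : ∀ K b → TwiceDeg≤ K b → ∀ M → rev (M + K) b ≋ X ^ M ⊠ rev K b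
rev-+ zero b h M = ≋-trans (rev-const (M + 0) b (TwiceDeg≤1⇒const 0 b z≤n h)) (≋-sym (X^⊠-mono M 0 (b 0)))
rev-+ (suc zero) b h M = ≋-trans (rev-const (M + 1) b (TwiceDeg≤1⇒const 1 b (s≤s z≤n) h)) (≋-sym (X^⊠-mono M 1 (b 0)))
rev-+ (suc (suc K)) b h M = begin
  rev (M + suc (suc K)) b                              ≈⟨ rev-idx b M+2+K ⟩
  mono (suc (suc (M + K))) (b 0) ⊞ rev (M + K) (tl b)  ≈⟨ ⊞-cong (≋-sym X^⊠-mono') (rev-+ K (tl b) (TwiceDeg≤-tl K b h) M) ⟩
  X ^ M ⊠ mono (suc (suc K)) (b 0) ⊞ X ^ M ⊠ rev K (tl b) ≈⟨ ≋-sym (⊠-distribˡ (X ^ M) _ _) ⟩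
  X ^ M ⊠ rev (suc (suc K)) b                          ∎
  where
  open ≋-Reasoning
  M+2+K : M + suc (suc K) ≡ suc (suc (M + K))
  M+2+K = trans (+-suc M (suc K)) (cong suc (+-suc M K))
  X^⊠-mono' : X ^ M ⊠ mono (suc (suc K)) (b 0) ≋ mono (suc (suc (M + K))) (b 0)
  X^⊠-mono' r = trans (X^⊠-mono M (suc (suc K)) (b 0) r) (cong (λ k → mono k (b 0) r) M+2+K)

rev-⊠ : ∀ J K a b → TwiceDeg≤ J a → TwiceDeg≤ K b → rev (J + K) (a ⊠ b) ≋ rev J a ⊠ rev K b
rev-⊠ zero K a b ha hb = begin
  rev K (a ⊠ b)            ≈⟨ rev-cong K (⊠-const a b (TwiceDeg≤1⇒const 0 a z≤n ha)) ⟩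
  rev K (scaleˢ (a 0) b)   ≈⟨ rev-scale K (a 0) b ⟩
  scaleˢ (a 0) (rev K b)   ≈⟨ ≋-sym (≋-trans (mono⊠ 0 (a 0) (rev K b)) (scale-cong (a 0) (⊠-identityˡ (rev K b)))) ⟩
  mono 0 (a 0) ⊠ rev K b   ∎
  where open ≋-Reasoning
rev-⊠ (suc zero) K a b ha hb = begin
  rev (suc K) (a ⊠ b)            ≈⟨ rev-cong (suc K) (⊠-const a b (TwiceDeg≤1⇒const 1 a (s≤s z≤n) ha)) ⟩
  rev (suc K) (scaleˢ (a 0) b)   ≈⟨ rev-scale (suc K) (a 0) b ⟩
  scaleˢ (a 0) (rev (1 + K) b)   ≈⟨ scale-cong (a 0) (rev-+ K b hb 1) ⟩
  scaleˢ (a 0) (X ^ 1 ⊠ rev K b) ≈⟨ ≋-sym (mono⊠ 1 (a 0) (rev K b)) ⟩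
  mono 1 (a 0) ⊠ rev K b         ∎
  where open ≋-Reasoning
rev-⊠ (suc (suc J)) K a b ha hb = begin
  rev (2 + J + K) (a ⊠ b)
    ≈⟨ rev-cong (2 + J + K) (⊠-split a b) ⟩
  rev (2 + J + K) (scaleˢ (a 0) b ⊞ mulX (tl a ⊠ b))
    ≈⟨ rev-⊞ (2 + J + K) (scaleˢ (a 0) b) (mulX (tl a ⊠ b)) ⟩
  rev (2 + J + K) (scaleˢ (a 0) b) ⊞ rev (2 + J + K) (mulX (tl a ⊠ b))
    ≈⟨ ⊞-cong (rev-scale (2 + J + K) (a 0) b) (rev-mulX (J + K) (tl a ⊠ b)) ⟩
  scaleˢ (a 0) (rev (2 + J + K) b) ⊞ rev (J + K) (tl a ⊠ b)
    ≈⟨ ⊞-cong (scale-cong (a 0) (rev-+ K b hb (2 + J))) (rev-⊠ J K (tl a) b (TwiceDeg≤-tl J a ha) hb) ⟩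
  scaleˢ (a 0) (X ^ (2 + J) ⊠ rev K b) ⊞ rev J (tl a) ⊠ rev K b
    ≈⟨ ⊞-cong (≋-sym (mono⊠ (2 + J) (a 0) (rev K b))) ≋-refl ⟩
  mono (2 + J) (a 0) ⊠ rev K b ⊞ rev J (tl a) ⊠ rev K b
    ≈⟨ ≋-sym (⊠-distribʳ _ _ (rev K b)) ⟩
  rev (2 + J) a ⊠ rev K b ∎
  where open ≋-Reasoning

TwiceDeg≤-⊠ : ∀ J K a b → TwiceDeg≤ J a → TwiceDeg≤ K b → TwiceDeg≤ (J + K) (a ⊠ b)
TwiceDeg≤-⊠ J K a b ha hb zero ()
TwiceDeg≤-⊠ J K a b ha hb (suc i) lt =
  cong₂ _+_ (trans (cong (a 0 *_) (hb (suc i) (≤-trans (s≤s (m≤n+m K J)) lt))) (*-zeroʳ (a 0))) (tail-vanishes J ha lt)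
  where
  tail-vanishes : ∀ J → TwiceDeg≤ J a → J + K < 2 * suc i → (tl a ⊠ b) i ≡ 0
  tail-vanishes zero ha _ = trans (⊠-cong (TwiceDeg≤1⇒const 0 a z≤n ha) (λ _ → refl) i) (⊠-zeroˡ b i)
  tail-vanishes (suc zero) ha _ = trans (⊠-cong (TwiceDeg≤1⇒const 1 a (s≤s z≤n) ha) (λ _ → refl) i) (⊠-zeroˡ b i)
  tail-vanishes (suc (suc J)) ha lt with subst (suc (suc (J + K)) <_) (*-suc 2 i) lt
  ... | s≤s (s≤s J+K<2i) = TwiceDeg≤-⊠ J K (tl a) b (TwiceDeg≤-tl J a ha) hb i J+K<2i

mono-local : ∀ k x y r → (r ≡ k → x ≡ y) → mono k x r ≡ mono k y r
mono-local zero x y zero h = h refl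
mono-local zero x y (suc r) h = refl
mono-local (suc k) x y zero h = refl
mono-local (suc k) x y (suc r) h = mono-local k x y r (λ e → h (cong suc e))

rev-local : ∀ N a b d → (∀ i → 2 * i + d ≡ N → a i ≡ b i) → rev N a d ≡ rev N b d
rev-local zero a b d h = mono-local 0 (a 0) (b 0) d (h 0)
rev-local (suc zero) a b d h = mono-local 1 (a 0) (b 0) d (h 0)
rev-local (suc (suc N)) a b d h = cong₂ _+_ (mono-local (suc (suc N)) (a 0) (b 0) d (h 0))
  (rev-local N (tl a) (tl b) d (λ i e → h (suc i) (trans (cong (_+ d) (*-suc 2 i)) (cong (λ z → suc (suc z)) e))))

rev-suc : ∀ N a d → rev (suc N) a (suc d) ≡ rev N a d
rev-suc zero a d = refl
rev-suc (suc zero) a d = +-identityʳ _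
rev-suc (suc (suc N)) a d = cong (mono (suc (suc N)) (a 0) d +_) (rev-suc N (tl a) d)

rev-beyond : ∀ N a r → N < r → rev N a r ≡ 0
rev-beyond zero a (suc r) _ = refl
rev-beyond (suc zero) a (suc zero) (s≤s ())
rev-beyond (suc zero) a (suc (suc r)) _ = refl
rev-beyond (suc (suc N)) a r N<r =
  cong₂ _+_ (mono-beyond (suc (suc N)) r N<r) (rev-beyond N (tl a) r (<-trans (n<1+n N) (<-trans (n<1+n (suc N)) N<r)))
  where
  mono-beyond : ∀ k r → k < r → mono k (a 0) r ≡ 0
  mono-beyond zero (suc r) _ = refl
  mono-beyond (suc k) (suc r) (s≤s k<r) = mono-beyond k r k<r

rev-at-2 : ∀ q a → rev (suc (suc (2 * q))) a 2 ≡ a q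
rev-at-2 zero a = trans (cong (a 0 +_) (rev-beyond 0 (tl a) 2 (s≤s z≤n))) (+-identityʳ _)
rev-at-2 (suc q) a = trans (rev-idx a (cong (λ z → suc (suc z)) (*-suc 2 q)) 2) (rev-at-2 q (tl a))

coeff-⊕ : ∀ p q → coeff (p ⊕ q) ≋ coeff p ⊞ coeff q
coeff-⊕ [] q i = refl
coeff-⊕ (a ∷ p) [] i = sym (+-identityʳ _)
coeff-⊕ (a ∷ p) (b ∷ q) zero = refl
coeff-⊕ (a ∷ p) (b ∷ q) (suc i) = coeff-⊕ p q i

coeff-scale : ∀ c q → coeff (scale c q) ≋ scaleˢ c (coeff q)
coeff-scale c [] i = sym (*-zeroʳ c)
coeff-scale c (b ∷ q) zero = refl
coeff-scale c (b ∷ q) (suc i) = coeff-scale c q i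

coeff-⊗ : ∀ p q → coeff (p ⊗ q) ≋ coeff p ⊠ coeff q
coeff-⊗ [] q i = sym (⊠-zeroˡ (coeff q) i)
coeff-⊗ (a ∷ p) q zero = trans (coeff-⊕ (scale a q) (0 ∷ (p ⊗ q)) 0) (trans (+-identityʳ _) (coeff-scale a q 0))
coeff-⊗ (a ∷ p) q (suc i) =
  trans (coeff-⊕ (scale a q) (0 ∷ (p ⊗ q)) (suc i)) (cong₂ _+_ (coeff-scale a q (suc i)) (coeff-⊗ p q i))

Deg< : ℕ → Ser → Set
Deg< t a = ∀ j → t ≤ j → a j ≡ 0

TwiceDeg≤⇒Deg< : ∀ J a i → TwiceDeg≤ J a → J < 2 * i → Deg< i a
TwiceDeg≤⇒Deg< J a i h lt j i≤j = h j (≤-trans lt (*-monoʳ-≤ 2 i≤j))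

coeff-shift∷ : ∀ a p → coeff (shift (a ∷ p)) ≋ coeff (a ∷ []) ⊞ (coeff (shift p) ⊞ coeff (0 ∷ shift p))
coeff-shift∷ a p i =
  trans (coeff-⊕ (a ∷ []) (timesMPlus1 (shift p)) i) (cong (coeff (a ∷ []) i +_) (coeff-⊕ (shift p) (0 ∷ shift p) i))

shift-Deg< : ∀ t p → Deg< t (coeff p) → Deg< t (coeff (shift p))
shift-Deg< t [] h j _ = refl
shift-Deg< zero (a ∷ p) h j _ = trans (coeff-shift∷ a p j) (vanish j)
  where
  hp : Deg< 0 (coeff (shift p))
  hp = shift-Deg< 0 p (λ j _ → h (suc j) z≤n)
  vanish : ∀ j → coeff (a ∷ []) j + (coeff (shift p) j + coeff (0 ∷ shift p) j) ≡ 0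
  vanish zero = cong₂ _+_ (h 0 z≤n) (cong (_+ 0) (hp 0 z≤n))
  vanish (suc j) = cong₂ _+_ refl (cong₂ _+_ (hp (suc j) z≤n) (hp j z≤n))
shift-Deg< (suc t) (a ∷ p) h (suc j) (s≤s t≤j) =
  trans (coeff-shift∷ a p (suc j)) (cong₂ _+_ refl (cong₂ _+_ (hp (suc j) (m≤n⇒m≤1+n t≤j)) (hp j t≤j)))
  where
  hp : Deg< t (coeff (shift p))
  hp = shift-Deg< t p (λ j t≤j → h (suc j) (s≤s t≤j))

shift-leading : ∀ s p → Deg< (suc s) (coeff p) → coeff (shift p) s ≡ coeff p s
shift-leading s [] h = refl
shift-leading zero (a ∷ p) h =
  trans (coeff-shift∷ a p 0) (trans (cong (a +_) (cong (_+ 0) (shift-Deg< 0 p (λ j _ → h (suc j) (s≤s z≤n)) 0 z≤n))) (+-identityʳ a))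
shift-leading (suc s) (a ∷ p) h = trans (coeff-shift∷ a p (suc s))
  (cong₂ _+_ refl (cong₂ _+_ (shift-Deg< (suc s) p hp (suc s) ≤-refl) (shift-leading s p hp)))
  where
  hp : Deg< (suc s) (coeff p)
  hp = λ j s≤j → h (suc j) (s≤s s≤j)

-- Convolution sums: convSum G n = Σ_{j+k=n} G j k

convSum : (ℕ → ℕ → ℕ) → ℕ → ℕ
convSum G zero = G 0 0
convSum G (suc n) = G (suc n) 0 + convSum (λ j k → G j (suc k)) n

convSum-cong : ∀ n G G' → (∀ j k → j + k ≡ n → G j k ≡ G' j k) → convSum G n ≡ convSum G' n
convSum-cong zero G G' h = h 0 0 refl
convSum-cong (suc n) G G' h = cong₂ _+_ (h (suc n) 0 (+-identityʳ (suc n)))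
  (convSum-cong n (λ j k → G j (suc k)) (λ j k → G' j (suc k)) (λ j k e → h j (suc k) (trans (+-suc j k) (cong suc e))))

convSum-⊞ : ∀ n G H → convSum (λ j k → G j k + H j k) n ≡ convSum G n + convSum H n
convSum-⊞ zero G H = refl
convSum-⊞ (suc n) G H = trans (cong (G (suc n) 0 + H (suc n) 0 +_) (convSum-⊞ n (λ j k → G j (suc k)) (λ j k → H j (suc k))))
  (+-interchange (G (suc n) 0) (H (suc n) 0) _ _)

convSum-⊠ : ∀ n a b → convSum (λ j k → a k * b j) n ≡ (a ⊠ b) n
convSum-⊠ zero a b = refl
convSum-⊠ (suc n) a b = cong (a 0 * b (suc n) +_) (convSum-⊠ n (tl a) b)

convSum-swap : ∀ n d (F : ℕ → ℕ → ℕ → ℕ → ℕ) →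
  convSum (λ j k → convSum (λ a b → F a b j k) d) n ≡ convSum (λ a b → convSum (λ j k → F a b j k) n) d
convSum-swap n zero F = refl
convSum-swap n (suc d) F = trans (convSum-⊞ n (λ j k → F (suc d) 0 j k) (λ j k → convSum (λ a b → F a (suc b) j k) d))
  (cong (convSum (λ j k → F (suc d) 0 j k) n +_) (convSum-swap n d (λ a b → F a (suc b))))

hist-suc : ∀ n → hist (suc n) ≡ (P (suc n) , Q (suc n)) ∷ hist n
hist-suc zero = refl
hist-suc (suc n) rewrite hist-suc n = refl

P-rec : ∀ n → P (suc n) ≡ shift (P n) ⊕ Q (suc n)
P-rec zero = refl
P-rec (suc n) = trans (cong (λ h → headP (next h)) (hist-suc n))
  (cong (shift (P (suc n)) ⊕_) (sym (cong (λ h → headQ (next h)) (hist-suc n))))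

Qs-in-hist : ∀ n → map proj₂ (hist n) ≡ applyDownFrom Q (suc n)
Qs-in-hist zero = refl
Qs-in-hist (suc n) = trans (cong (map proj₂) (hist-suc n)) (cong (Q (suc n) ∷_) (Qs-in-hist n))

Ps-in-hist : ∀ n → map proj₁ (hist n) ≡ applyDownFrom P (suc n)
Ps-in-hist zero = refl
Ps-in-hist (suc n) = trans (cong (map proj₁) (hist-suc n)) (cong (P (suc n) ∷_) (Ps-in-hist n))

Additive : (Poly → ℕ) → Set
Additive f = (f [] ≡ 0) × (∀ p q → f (p ⊕ q) ≡ f p + f q)

additive-polySum : ∀ f → Additive f → ∀ L → f (polySum L) ≡ sum (map f L)
additive-polySum f (f[] , f⊕) [] = f[]
additive-polySum f (f[] , f⊕) (p ∷ L) = trans (f⊕ p (polySum L)) (cong (f p +_) (additive-polySum f (f[] , f⊕) L))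

sum-zip-convSum : ∀ f (A B : ℕ → Poly) n →
  sum (map f (zipWith _⊗_ (applyDownFrom A (suc n)) (applyUpTo B (suc n)))) ≡ convSum (λ j k → f (A j ⊗ B k)) n
sum-zip-convSum f A B zero = +-identityʳ _
sum-zip-convSum f A B (suc n) = cong (f (A (suc n) ⊗ B 0) +_) (sum-zip-convSum f A (λ k → B (suc k)) n)

Q-rec : ∀ f → Additive f → ∀ n → f (Q (suc (suc n))) ≡ convSum (λ j k → f (Q j ⊗ P k)) (suc n)
Q-rec f additive n = begin
  f (Q (suc (suc n)))
    ≡⟨ cong (λ h → f (headQ (next h))) (hist-suc n) ⟩
  f (polySum (zipWith _⊗_ (Q (suc n) ∷ map proj₂ (hist n)) (reverse (P (suc n) ∷ map proj₁ (hist n)))))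
    ≡⟨ cong₂ (λ qs ps → f (polySum (zipWith _⊗_ qs ps))) (cong (Q (suc n) ∷_) (Qs-in-hist n)) Ps-reversed ⟩
  f (polySum (zipWith _⊗_ (applyDownFrom Q (suc (suc n))) (applyUpTo P (suc (suc n)))))
    ≡⟨ additive-polySum f additive (zipWith _⊗_ (applyDownFrom Q (suc (suc n))) (applyUpTo P (suc (suc n)))) ⟩
  sum (map f (zipWith _⊗_ (applyDownFrom Q (suc (suc n))) (applyUpTo P (suc (suc n)))))
    ≡⟨ sum-zip-convSum f Q P (suc n) ⟩
  convSum (λ j k → f (Q j ⊗ P k)) (suc n) ∎
  where
  open ≡-Reasoning
  Ps-reversed : reverse (P (suc n) ∷ map proj₁ (hist n)) ≡ applyUpTo P (suc (suc n))
  Ps-reversed = trans (cong (λ ps → reverse (P (suc n) ∷ ps)) (Ps-in-hist n)) (reverse-applyDownFrom P (suc (suc n)))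

DegBounds : ℕ → Set
DegBounds n = TwiceDeg≤ (suc n) (coeff (P n)) × TwiceDeg≤ (suc n) (coeff (Q n))

coeff-additive : ∀ i → Additive (λ p → coeff p i)
coeff-additive i = refl , (λ p q → coeff-⊕ p q i)

convSum-zero : ∀ n → convSum (λ _ _ → 0) n ≡ 0
convSum-zero zero = refl
convSum-zero (suc n) = convSum-zero n

shift-TwiceDeg≤ : ∀ J p → TwiceDeg≤ J (coeff p) → TwiceDeg≤ J (coeff (shift p))
shift-TwiceDeg≤ J p h i lt = shift-Deg< i p (TwiceDeg≤⇒Deg< J (coeff p) i h lt) i ≤-refl

Q₁-bound : TwiceDeg≤ 2 (coeff (Q 1))
Q₁-bound zero ()
Q₁-bound (suc zero) (s≤s (s≤s ()))
Q₁-bound (suc (suc i)) _ = refl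

Q-bound : ∀ n → (∀ {k} → k < suc (suc n) → DegBounds k) → TwiceDeg≤ (3 + n) (coeff (Q (2 + n)))
Q-bound n ih i lt = begin
  coeff (Q (2 + n)) i                              ≡⟨ Q-rec (λ p → coeff p i) (coeff-additive i) n ⟩
  convSum (λ j k → coeff (Q j ⊗ P k) i) (suc n)    ≡⟨ convSum-cong (suc n) _ (λ _ _ → 0) term-vanishes ⟩
  convSum (λ _ _ → 0) (suc n)                      ≡⟨ convSum-zero (suc n) ⟩
  0                                                ∎
  where
  open ≡-Reasoning
  term-vanishes : ∀ j k → j + k ≡ suc n → coeff (Q j ⊗ P k) i ≡ 0
  term-vanishes j k e = trans (coeff-⊗ (Q j) (P k) i)
    (TwiceDeg≤-⊠ (suc j) (suc k) (coeff (Q j)) (coeff (P k))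
      (proj₂ (ih (s≤s (subst (j ≤_) e (m≤m+n j k))))) (proj₁ (ih (s≤s (subst (k ≤_) e (m≤n+m k j)))))
      i (subst (_< 2 * i) (sym (trans (+-suc (suc j) k) (cong (λ z → suc (suc z)) e))) lt))

P-bound : ∀ n → DegBounds n → TwiceDeg≤ (2 + n) (coeff (Q (suc n))) → TwiceDeg≤ (2 + n) (coeff (P (suc n)))
P-bound n (Pₙ-bound , _) Qₙ₊₁-bound i lt = begin
  coeff (P (suc n)) i                               ≡⟨ cong (λ p → coeff p i) (P-rec n) ⟩
  coeff (shift (P n) ⊕ Q (suc n)) i                 ≡⟨ coeff-⊕ (shift (P n)) (Q (suc n)) i ⟩
  coeff (shift (P n)) i + coeff (Q (suc n)) i       ≡⟨ cong₂ _+_ (shift-TwiceDeg≤ (2 + n) (P n) Pₙ-bound' i lt) (Qₙ₊₁-bound i lt) ⟩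
  0                                                 ∎
  where
  open ≡-Reasoning
  Pₙ-bound' : TwiceDeg≤ (2 + n) (coeff (P n))
  Pₙ-bound' i lt = Pₙ-bound i (<-trans (n<1+n (suc n)) lt)

degBounds : ∀ n → DegBounds n
degBounds = <-rec DegBounds step
  where
  step : ∀ n → (∀ {k} → k < n → DegBounds k) → DegBounds n
  step zero _ = (λ i _ → refl) , (λ i _ → refl)
  step (suc zero) ih = P-bound 0 (ih (s≤s z≤n)) Q₁-bound , Q₁-bound
  step (suc (suc n)) ih = P-bound (suc n) (ih ≤-refl) (Q-bound n ih) , Q-bound n ih

-- Diagonal generating functions: gP d = Σₙ [m^i] Pₙ · xⁿ over 2i + d = n + 1, and likewise gQ d

gP : ℕ → Ser
gP d n = rev (suc n) (coeff (P n)) d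

gQ : ℕ → Ser
gQ d n = rev (suc n) (coeff (Q n)) d

φ-diagonal : ∀ q → φ q ≡ gP 2 (suc (2 * q))
φ-diagonal q = sym (rev-at-2 q (coeff (P (suc (2 * q)))))

rev-coeff-additive : ∀ N d → Additive (λ p → rev N (coeff p) d)
rev-coeff-additive N d = rev-0 N d , λ p q → trans (rev-cong N (coeff-⊕ p q) d) (rev-⊞ N (coeff p) (coeff q) d)

gQ-rec : ∀ d n → gQ d (suc (suc n)) ≡ convSum (λ a b → (gP b ⊠ gQ a) (suc n)) d
gQ-rec d n = begin
  gQ d (suc (suc n))
    ≡⟨ Q-rec (λ p → rev (3 + n) (coeff p) d) (rev-coeff-additive (3 + n) d) n ⟩
  convSum (λ j k → rev (3 + n) (coeff (Q j ⊗ P k)) d) (suc n)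
    ≡⟨ convSum-cong (suc n) _ _ product-term ⟩
  convSum (λ j k → convSum (λ a b → gP b k * gQ a j) d) (suc n)
    ≡⟨ convSum-swap (suc n) d (λ a b j k → gP b k * gQ a j) ⟩
  convSum (λ a b → convSum (λ j k → gP b k * gQ a j) (suc n)) d
    ≡⟨ convSum-cong d _ _ (λ a b _ → convSum-⊠ (suc n) (gP b) (gQ a)) ⟩
  convSum (λ a b → (gP b ⊠ gQ a) (suc n)) d ∎
  where
  open ≡-Reasoning
  product-term : ∀ j k → j + k ≡ suc n → rev (3 + n) (coeff (Q j ⊗ P k)) d ≡ convSum (λ a b → gP b k * gQ a j) d
  product-term j k e = begin
    rev (3 + n) (coeff (Q j ⊗ P k)) d
      ≡⟨ rev-idx (coeff (Q j ⊗ P k)) (sym (trans (+-suc (suc j) k) (cong (λ z → suc (suc z)) e))) d ⟩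
    rev (suc j + suc k) (coeff (Q j ⊗ P k)) d
      ≡⟨ rev-cong (suc j + suc k) (coeff-⊗ (Q j) (P k)) d ⟩
    rev (suc j + suc k) (coeff (Q j) ⊠ coeff (P k)) d
      ≡⟨ rev-⊠ (suc j) (suc k) (coeff (Q j)) (coeff (P k)) (proj₂ (degBounds j)) (proj₁ (degBounds k)) d ⟩
    ((λ r → gQ r j) ⊠ (λ r → gP r k)) d
      ≡⟨ ⊠-comm (λ r → gQ r j) (λ r → gP r k) d ⟩
    ((λ r → gP r k) ⊠ (λ r → gQ r j)) d
      ≡⟨ sym (convSum-⊠ d (λ r → gP r k) (λ r → gQ r j)) ⟩
    convSum (λ a b → gP b k * gQ a j) d ∎

gQ₀-eq : gQ 0 ≋ mulX (1ˢ ⊞ gP 0 ⊠ gQ 0)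
gQ₀-eq zero = refl
gQ₀-eq (suc zero) = refl
gQ₀-eq (suc (suc n)) = gQ-rec 0 n

gQ₁-eq : gQ 1 ≋ mulX (gP 0 ⊠ gQ 1 ⊞ gP 1 ⊠ gQ 0)
gQ₁-eq zero = refl
gQ₁-eq (suc zero) = refl
gQ₁-eq (suc (suc n)) = gQ-rec 1 n

gQ₂-eq : gQ 2 ≋ mulX (gP 0 ⊠ gQ 2 ⊞ (gP 1 ⊠ gQ 1 ⊞ gP 2 ⊠ gQ 0))
gQ₂-eq zero = refl
gQ₂-eq (suc zero) = refl
gQ₂-eq (suc (suc n)) = gQ-rec 2 n

gP-step : ∀ n d → gP d (suc n) ≡ rev (suc (suc n)) (coeff (shift (P n))) d + gQ d (suc n)
gP-step n d = trans (cong (λ p → rev (suc (suc n)) (coeff p) d) (P-rec n))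
  (trans (rev-cong (suc (suc n)) (coeff-⊕ (shift (P n)) (Q (suc n))) d) (rev-⊞ (suc (suc n)) (coeff (shift (P n))) (coeff (Q (suc n))) d))

-- on the main diagonal Pₙ(m+1) contributes nothing …
gP₀≋gQ₀ : gP 0 ≋ gQ 0
gP₀≋gQ₀ zero = refl
gP₀≋gQ₀ (suc n) = trans (gP-step n 0)
  (cong (_+ gQ 0 (suc n)) (trans (rev-local (suc (suc n)) _ 0ˢ 0 above-degree) (rev-0 (suc (suc n)) 0)))
  where
  above-degree : ∀ i → 2 * i + 0 ≡ suc (suc n) → coeff (shift (P n)) i ≡ 0
  above-degree i e = shift-TwiceDeg≤ (suc n) (P n) (proj₁ (degBounds n)) i
    (subst (suc n <_) (sym (trans (sym (+-identityʳ (2 * i))) e)) ≤-refl)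

-- … and on the next two diagonals it contributes the previous diagonal of Pₙ (leading coefficients)
gP-suc-eq : ∀ d → d ≤ 1 → gP (suc d) ≋ mulX (gP d) ⊞ gQ (suc d)
gP-suc-eq d d≤1 zero = refl
gP-suc-eq d d≤1 (suc n) = trans (gP-step n (suc d))
  (cong (_+ gQ (suc d) (suc n)) (trans (rev-suc (suc n) _ d) (rev-local (suc n) _ _ d leading)))
  where
  leading : ∀ i → 2 * i + d ≡ suc n → coeff (shift (P n)) i ≡ coeff (P n) i
  leading i e = shift-leading i (P n) (TwiceDeg≤⇒Deg< (suc n) (coeff (P n)) (suc i) (proj₁ (degBounds n))
    (subst (_< 2 * suc i) e (subst (2 * i + d <_) (sym (*-suc 2 i))
      (s≤s (≤-trans (+-monoʳ-≤ (2 * i) d≤1) (≤-reflexive (+-comm (2 * i) 1)))))))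

module SeriesSolver = Algebra.Solver.Ring.NaturalCoefficients seriesSemiring (λ _ _ → nothing)

module Solution where
  open SeriesSolver
  open ≋-Reasoning

  -- the diagonals entering φ; A is both gP 0 and gQ 0
  A B C B₂ C₂ : Ser
  A = gQ 0
  B = gP 1
  C = gQ 1
  B₂ = gP 2
  C₂ = gQ 2

  A-eq : A ≋ X ⊠ (1ˢ ⊞ A ⊠ A)
  A-eq = ≋-trans gQ₀-eq (≋-trans (mulX≋X⊠ _) (⊠-cong {X} ≋-refl (⊞-cong {1ˢ} ≋-refl (⊠-cong gP₀≋gQ₀ ≋-refl))))

  B-eq : B ≋ X ⊠ A ⊞ C
  B-eq = ≋-trans (gP-suc-eq 0 z≤n) (⊞-cong (≋-trans (mulX≋X⊠ _) (⊠-cong {X} ≋-refl gP₀≋gQ₀)) ≋-refl)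

  C-eq : C ≋ X ⊠ (A ⊠ C ⊞ B ⊠ A)
  C-eq = ≋-trans gQ₁-eq (≋-trans (mulX≋X⊠ _) (⊠-cong {X} ≋-refl (⊞-cong (⊠-cong gP₀≋gQ₀ ≋-refl) ≋-refl)))

  B₂-eq : B₂ ≋ X ⊠ B ⊞ C₂
  B₂-eq = ≋-trans (gP-suc-eq 1 (s≤s z≤n)) (⊞-cong (mulX≋X⊠ _) ≋-refl)

  C₂-eq : C₂ ≋ X ⊠ (A ⊠ C₂ ⊞ (B ⊠ C ⊞ B₂ ⊠ A))
  C₂-eq = ≋-trans gQ₂-eq (≋-trans (mulX≋X⊠ _) (⊠-cong {X} ≋-refl (⊞-cong (⊠-cong gP₀≋gQ₀ ≋-refl) ≋-refl)))

  -- B starts at x², and T = B / x² is the series governing everything else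
  T : Ser
  T = tl (tl B)

  B≋X²T : B ≋ X ^ 2 ⊠ T
  B≋X²T zero = refl
  B≋X²T (suc zero) = refl
  B≋X²T (suc (suc n)) = sym (X^⊠-coeff 2 T n)

  -- eliminating B from the equation for C, and then C from that for B, leaves
  -- linear equations with the same multiplier x·2A
  C-lin : C ≋ X ^ 2 ⊠ A ⊠ A ⊞ X ⊠ (κ 2 ⊠ A) ⊠ C
  C-lin = begin
    C                                    ≈⟨ C-eq ⟩
    X ⊠ (A ⊠ C ⊞ B ⊠ A)                  ≈⟨ ⊠-cong {X} ≋-refl (⊞-cong {A ⊠ C} ≋-refl (⊠-cong B-eq ≋-refl)) ⟩
    X ⊠ (A ⊠ C ⊞ (X ⊠ A ⊞ C) ⊠ A)        ≈⟨ solve 3 (λ x a c → x :* (a :* c :+ (x :* a :+ c) :* a)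
                                                    := x :^ 2 :* a :* a :+ x :* (con 2 :* a) :* c) ≋-refl X A C ⟩
    X ^ 2 ⊠ A ⊠ A ⊞ X ⊠ (κ 2 ⊠ A) ⊠ C   ∎

  B-lin : B ≋ X ^ 2 ⊞ X ⊠ (κ 2 ⊠ A) ⊠ B
  B-lin = begin
    B                                              ≈⟨ B-eq ⟩
    X ⊠ A ⊞ C                                      ≈⟨ ⊞-cong (⊠-cong {X} ≋-refl A-eq) C-lin ⟩
    X ⊠ (X ⊠ (1ˢ ⊞ A ⊠ A)) ⊞ (X ^ 2 ⊠ A ⊠ A ⊞ X ⊠ (κ 2 ⊠ A) ⊠ C)
      ≈⟨ solve 3 (λ x a c → x :* (x :* (con 1 :+ a :* a)) :+ (x :^ 2 :* a :* a :+ x :* (con 2 :* a) :* c)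
                            := x :^ 2 :+ x :* (con 2 :* a) :* (x :* a :+ c)) ≋-refl X A C ⟩
    X ^ 2 ⊞ X ⊠ (κ 2 ⊠ A) ⊠ (X ⊠ A ⊞ C)            ≈⟨ ⊞-cong {X ^ 2} ≋-refl (⊠-cong {X ⊠ (κ 2 ⊠ A)} ≋-refl (≋-sym B-eq)) ⟩
    X ^ 2 ⊞ X ⊠ (κ 2 ⊠ A) ⊠ B                      ∎

  T-eq : T ≋ 1ˢ ⊞ X ⊠ (κ 2 ⊠ A) ⊠ T
  T-eq = X-cancel (X-cancel (begin
    X ⊠ (X ⊠ T)                            ≈⟨ solve 2 (λ x t → x :* (x :* t) := x :^ 2 :* t) ≋-refl X T ⟩
    X ^ 2 ⊠ T                              ≈⟨ ≋-sym B≋X²T ⟩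
    B                                      ≈⟨ B-lin ⟩
    X ^ 2 ⊞ X ⊠ (κ 2 ⊠ A) ⊠ B              ≈⟨ ⊞-cong {X ^ 2} ≋-refl (⊠-cong {X ⊠ (κ 2 ⊠ A)} ≋-refl B≋X²T) ⟩
    X ^ 2 ⊞ X ⊠ (κ 2 ⊠ A) ⊠ (X ^ 2 ⊠ T)
      ≈⟨ solve 3 (λ x a t → x :^ 2 :+ x :* (con 2 :* a) :* (x :^ 2 :* t)
                            := x :* (x :* (con 1 :+ x :* (con 2 :* a) :* t))) ≋-refl X A T ⟩
    X ⊠ (X ⊠ (1ˢ ⊞ X ⊠ (κ 2 ⊠ A) ⊠ T))    ∎))

  -- T has constant term 1, so it is cancellable
  T₀≡1 : T 0 ≡ 1
  T₀≡1 = T-eq 0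

  -- A + AT = 2xT: both sides solve Z = 2x + x·2A·Z
  A+AT≋2XT : A ⊞ A ⊠ T ≋ κ 2 ⊠ X ⊠ T
  A+AT≋2XT = unique-solution (κ 2 ⊠ X) (κ 2 ⊠ A) lhs-eq rhs-eq
    where
    lhs-eq : A ⊞ A ⊠ T ≋ κ 2 ⊠ X ⊞ X ⊠ (κ 2 ⊠ A) ⊠ (A ⊞ A ⊠ T)
    lhs-eq = begin
      A ⊞ A ⊠ T                                        ≈⟨ ⊞-cong {A} ≋-refl (⊠-cong {A} ≋-refl T-eq) ⟩
      A ⊞ A ⊠ (1ˢ ⊞ X ⊠ (κ 2 ⊠ A) ⊠ T)
        ≈⟨ solve 3 (λ x a t → a :+ a :* (con 1 :+ x :* (con 2 :* a) :* t)
                              := con 2 :* a :+ x :* (con 2 :* a) :* (a :* t)) ≋-refl X A T ⟩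
      κ 2 ⊠ A ⊞ X ⊠ (κ 2 ⊠ A) ⊠ (A ⊠ T)                ≈⟨ ⊞-cong (⊠-cong {κ 2} ≋-refl A-eq) ≋-refl ⟩
      κ 2 ⊠ (X ⊠ (1ˢ ⊞ A ⊠ A)) ⊞ X ⊠ (κ 2 ⊠ A) ⊠ (A ⊠ T)
        ≈⟨ solve 3 (λ x a t → con 2 :* (x :* (con 1 :+ a :* a)) :+ x :* (con 2 :* a) :* (a :* t)
                              := con 2 :* x :+ x :* (con 2 :* a) :* (a :+ a :* t)) ≋-refl X A T ⟩
      κ 2 ⊠ X ⊞ X ⊠ (κ 2 ⊠ A) ⊠ (A ⊞ A ⊠ T)            ∎
    rhs-eq : κ 2 ⊠ X ⊠ T ≋ κ 2 ⊠ X ⊞ X ⊠ (κ 2 ⊠ A) ⊠ (κ 2 ⊠ X ⊠ T)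
    rhs-eq = begin
      κ 2 ⊠ X ⊠ T                                      ≈⟨ ⊠-cong {κ 2 ⊠ X} ≋-refl T-eq ⟩
      κ 2 ⊠ X ⊠ (1ˢ ⊞ X ⊠ (κ 2 ⊠ A) ⊠ T)
        ≈⟨ solve 3 (λ x a t → con 2 :* x :* (con 1 :+ x :* (con 2 :* a) :* t)
                              := con 2 :* x :+ x :* (con 2 :* a) :* (con 2 :* x :* t)) ≋-refl X A T ⟩
      κ 2 ⊠ X ⊞ X ⊠ (κ 2 ⊠ A) ⊠ (κ 2 ⊠ X ⊠ T)          ∎

  -- T² = 1 / (1 - 4x²), written with the factor x·x exposed for the Euler operator
  T²-eq : T ⊠ T ≋ 1ˢ ⊞ κ 4 ⊠ (X ⊠ (X ⊠ (T ⊠ T)))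
  T²-eq = begin
    T ⊠ T                                              ≈⟨ ⊠-cong {T} ≋-refl T-eq ⟩
    T ⊠ (1ˢ ⊞ X ⊠ (κ 2 ⊠ A) ⊠ T)
      ≈⟨ solve 3 (λ x a t → t :* (con 1 :+ x :* (con 2 :* a) :* t) := t :+ x :* (con 2 :* t) :* (a :* t)) ≋-refl X A T ⟩
    T ⊞ X ⊠ (κ 2 ⊠ T) ⊠ (A ⊠ T)                        ≈⟨ ⊞-cong T-eq ≋-refl ⟩
    (1ˢ ⊞ X ⊠ (κ 2 ⊠ A) ⊠ T) ⊞ X ⊠ (κ 2 ⊠ T) ⊠ (A ⊠ T)
      ≈⟨ solve 3 (λ x a t → (con 1 :+ x :* (con 2 :* a) :* t) :+ x :* (con 2 :* t) :* (a :* t)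
                            := con 1 :+ x :* (con 2 :* t) :* (a :+ a :* t)) ≋-refl X A T ⟩
    1ˢ ⊞ X ⊠ (κ 2 ⊠ T) ⊠ (A ⊞ A ⊠ T)                   ≈⟨ ⊞-cong {1ˢ} ≋-refl (⊠-cong {X ⊠ (κ 2 ⊠ T)} ≋-refl A+AT≋2XT) ⟩
    1ˢ ⊞ X ⊠ (κ 2 ⊠ T) ⊠ (κ 2 ⊠ X ⊠ T)
      ≈⟨ solve 2 (λ x t → con 1 :+ x :* (con 2 :* t) :* (con 2 :* x :* t) := con 1 :+ con 4 :* (x :* (x :* (t :* t)))) ≋-refl X T ⟩
    1ˢ ⊞ κ 4 ⊠ (X ⊠ (X ⊠ (T ⊠ T)))                      ∎

  -- xT = A + xA²T, from A + AT = 2xT and A = x(1 + A²)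
  XT-eq : X ⊠ T ≋ A ⊞ X ⊠ A ⊠ A ⊠ T
  XT-eq = ⊞-cancelˡ (X ⊠ T) (begin
    X ⊠ T ⊞ X ⊠ T                      ≈⟨ solve 2 (λ x t → x :* t :+ x :* t := con 2 :* x :* t) ≋-refl X T ⟩
    κ 2 ⊠ X ⊠ T                        ≈⟨ ≋-sym A+AT≋2XT ⟩
    A ⊞ A ⊠ T                          ≈⟨ ⊞-cong {A} ≋-refl (⊠-cong A-eq ≋-refl) ⟩
    A ⊞ X ⊠ (1ˢ ⊞ A ⊠ A) ⊠ T
      ≈⟨ solve 3 (λ x a t → a :+ x :* (con 1 :+ a :* a) :* t := x :* t :+ (a :+ x :* a :* a :* t)) ≋-refl X A T ⟩
    X ⊠ T ⊞ (A ⊞ X ⊠ A ⊠ A ⊠ T)       ∎)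

  -- C = x²A²T: both sides solve Z = x²A² + x·2A·Z
  C-closed : C ≋ X ^ 2 ⊠ A ⊠ A ⊠ T
  C-closed = unique-solution (X ^ 2 ⊠ A ⊠ A) (κ 2 ⊠ A) C-lin (begin
    X ^ 2 ⊠ A ⊠ A ⊠ T                            ≈⟨ ⊠-cong {X ^ 2 ⊠ A ⊠ A} ≋-refl T-eq ⟩
    X ^ 2 ⊠ A ⊠ A ⊠ (1ˢ ⊞ X ⊠ (κ 2 ⊠ A) ⊠ T)
      ≈⟨ solve 3 (λ x a t → x :^ 2 :* a :* a :* (con 1 :+ x :* (con 2 :* a) :* t)
                            := x :^ 2 :* a :* a :+ x :* (con 2 :* a) :* (x :^ 2 :* a :* a :* t)) ≋-refl X A T ⟩
    X ^ 2 ⊠ A ⊠ A ⊞ X ⊠ (κ 2 ⊠ A) ⊠ (X ^ 2 ⊠ A ⊠ A ⊠ T) ∎)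

  -- C₂ = x⁵T³: both sides solve Z = c + x·2A·Z
  C₂-closed : C₂ ≋ X ^ 5 ⊠ (T ⊠ T ⊠ T)
  C₂-closed = unique-solution c (κ 2 ⊠ A) C₂-lin (begin
    X ^ 5 ⊠ (T ⊠ T ⊠ T)
      ≈⟨ solve 2 (λ x t → x :^ 5 :* (t :* t :* t) := x :^ 4 :* t :* (x :* t :* t)) ≋-refl X T ⟩
    X ^ 4 ⊠ T ⊠ (X ⊠ T ⊠ T)                     ≈⟨ ⊠-cong {X ^ 4 ⊠ T} ≋-refl (⊠-cong {X ⊠ T} ≋-refl T-eq) ⟩
    X ^ 4 ⊠ T ⊠ (X ⊠ T ⊠ (1ˢ ⊞ X ⊠ (κ 2 ⊠ A) ⊠ T))
      ≈⟨ solve 3 (λ x a t → x :^ 4 :* t :* (x :* t :* (con 1 :+ x :* (con 2 :* a) :* t))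
                            := x :^ 4 :* t :* (x :* t :+ x :^ 2 :* (con 2 :* a) :* t :* t)) ≋-refl X A T ⟩
    X ^ 4 ⊠ T ⊠ (X ⊠ T ⊞ X ^ 2 ⊠ (κ 2 ⊠ A) ⊠ T ⊠ T) ≈⟨ ⊠-cong {X ^ 4 ⊠ T} ≋-refl (⊞-cong XT-eq ≋-refl) ⟩
    X ^ 4 ⊠ T ⊠ ((A ⊞ X ⊠ A ⊠ A ⊠ T) ⊞ X ^ 2 ⊠ (κ 2 ⊠ A) ⊠ T ⊠ T)
      ≈⟨ solve 3 (λ x a t → x :^ 4 :* t :* ((a :+ x :* a :* a :* t) :+ x :^ 2 :* (con 2 :* a) :* t :* t)
                            := (x :^ 4 :* a :* t :+ x :^ 5 :* a :* a :* t :* t) :+ x :* (con 2 :* a) :* (x :^ 5 :* (t :* t :* t)))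
           ≋-refl X A T ⟩
    c ⊞ X ⊠ (κ 2 ⊠ A) ⊠ (X ^ 5 ⊠ (T ⊠ T ⊠ T))    ∎)
    where
    c : Ser
    c = X ^ 4 ⊠ A ⊠ T ⊞ X ^ 5 ⊠ A ⊠ A ⊠ T ⊠ T
    C₂-lin : C₂ ≋ c ⊞ X ⊠ (κ 2 ⊠ A) ⊠ C₂
    C₂-lin = begin
      C₂                                                 ≈⟨ C₂-eq ⟩
      X ⊠ (A ⊠ C₂ ⊞ (B ⊠ C ⊞ B₂ ⊠ A))
        ≈⟨ ⊠-cong {X} ≋-refl (⊞-cong {A ⊠ C₂} ≋-refl (⊞-cong (⊠-cong B≋X²T C-closed)
             (⊠-cong (≋-trans B₂-eq (⊞-cong (⊠-cong {X} ≋-refl B≋X²T) ≋-refl)) ≋-refl))) ⟩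
      X ⊠ (A ⊠ C₂ ⊞ (X ^ 2 ⊠ T ⊠ (X ^ 2 ⊠ A ⊠ A ⊠ T) ⊞ (X ⊠ (X ^ 2 ⊠ T) ⊞ C₂) ⊠ A))
        ≈⟨ solve 4 (λ x a t z → x :* (a :* z :+ (x :^ 2 :* t :* (x :^ 2 :* a :* a :* t) :+ (x :* (x :^ 2 :* t) :+ z) :* a))
                              := (x :^ 4 :* a :* t :+ x :^ 5 :* a :* a :* t :* t) :+ x :* (con 2 :* a) :* z) ≋-refl X A T C₂ ⟩
      c ⊞ X ⊠ (κ 2 ⊠ A) ⊠ C₂                             ∎

  B₂-closed : B₂ ≋ X ^ 3 ⊠ T ⊞ X ^ 5 ⊠ (T ⊠ T ⊠ T)
  B₂-closed = begin
    B₂                                  ≈⟨ B₂-eq ⟩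
    X ⊠ B ⊞ C₂                          ≈⟨ ⊞-cong (⊠-cong {X} ≋-refl B≋X²T) C₂-closed ⟩
    X ⊠ (X ^ 2 ⊠ T) ⊞ X ^ 5 ⊠ (T ⊠ T ⊠ T)
      ≈⟨ ⊞-cong (solve 2 (λ x t → x :* (x :^ 2 :* t) := x :^ 3 :* t) ≋-refl X T) ≋-refl ⟩
    X ^ 3 ⊠ T ⊞ X ^ 5 ⊠ (T ⊠ T ⊠ T)     ∎

  -- applying θ to T² = 1 + 4x²T² gives a linear equation for θT
  θT-eq : θ T ≋ κ 4 ⊠ (X ^ 2 ⊠ (T ⊞ θ T))
  θT-eq = κ-cancel 2 (unit-cancel T T₀≡1 (begin
    T ⊠ (κ 2 ⊠ θ T)                          ≈⟨ solve 2 (λ t u → t :* (con 2 :* u) := u :* t :+ t :* u) ≋-refl T (θ T) ⟩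
    θ T ⊠ T ⊞ T ⊠ θ T                        ≈⟨ ≋-sym (θ-⊠ T T) ⟩
    θ (T ⊠ T)                                ≈⟨ θ-cong T²-eq ⟩
    θ (1ˢ ⊞ κ 4 ⊠ (X ⊠ (X ⊠ (T ⊠ T))))       ≈⟨ θ-⊞ 1ˢ _ ⟩
    θ 1ˢ ⊞ θ (κ 4 ⊠ (X ⊠ (X ⊠ (T ⊠ T))))     ≈⟨ ⊞-cong (θ-κ 1) (θ-κ⊠ 4 _) ⟩
    κ 4 ⊠ θ (X ⊠ (X ⊠ (T ⊠ T)))              ≈⟨ ⊠-cong {κ 4} ≋-refl (θ-X⊠ _) ⟩
    κ 4 ⊠ (X ⊠ (X ⊠ (T ⊠ T) ⊞ θ (X ⊠ (T ⊠ T))))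
      ≈⟨ ⊠-cong {κ 4} ≋-refl (⊠-cong {X} ≋-refl (⊞-cong {X ⊠ (T ⊠ T)} ≋-refl (θ-X⊠ _))) ⟩
    κ 4 ⊠ (X ⊠ (X ⊠ (T ⊠ T) ⊞ X ⊠ (T ⊠ T ⊞ θ (T ⊠ T))))
      ≈⟨ ⊠-cong {κ 4} ≋-refl (⊠-cong {X} ≋-refl (⊞-cong {X ⊠ (T ⊠ T)} ≋-refl
           (⊠-cong {X} ≋-refl (⊞-cong {T ⊠ T} ≋-refl (θ-⊠ T T))))) ⟩
    κ 4 ⊠ (X ⊠ (X ⊠ (T ⊠ T) ⊞ X ⊠ (T ⊠ T ⊞ (θ T ⊠ T ⊞ T ⊠ θ T))))
      ≈⟨ solve 3 (λ x t u → con 4 :* (x :* (x :* (t :* t) :+ x :* (t :* t :+ (u :* t :+ t :* u))))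
                            := t :* (con 2 :* (con 4 :* (x :^ 2 :* (t :+ u))))) ≋-refl X T (θ T) ⟩
    T ⊠ (κ 2 ⊠ (κ 4 ⊠ (X ^ 2 ⊠ (T ⊞ θ T)))) ∎))

  -- hence θT = 4x²T³: both sides solve Z = 4x²T + x·4x·Z
  θT-closed : θ T ≋ κ 4 ⊠ (X ^ 2 ⊠ (T ⊠ T ⊠ T))
  θT-closed = unique-solution (κ 4 ⊠ (X ^ 2 ⊠ T)) (κ 4 ⊠ X) θT-lin (begin
    κ 4 ⊠ (X ^ 2 ⊠ (T ⊠ T ⊠ T))
      ≈⟨ solve 2 (λ x t → con 4 :* (x :^ 2 :* (t :* t :* t)) := con 4 :* (x :^ 2 :* t) :* (t :* t)) ≋-refl X T ⟩
    κ 4 ⊠ (X ^ 2 ⊠ T) ⊠ (T ⊠ T)                 ≈⟨ ⊠-cong {κ 4 ⊠ (X ^ 2 ⊠ T)} ≋-refl T²-eq ⟩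
    κ 4 ⊠ (X ^ 2 ⊠ T) ⊠ (1ˢ ⊞ κ 4 ⊠ (X ⊠ (X ⊠ (T ⊠ T))))
      ≈⟨ solve 2 (λ x t → con 4 :* (x :^ 2 :* t) :* (con 1 :+ con 4 :* (x :* (x :* (t :* t))))
                          := con 4 :* (x :^ 2 :* t) :+ x :* (con 4 :* x) :* (con 4 :* (x :^ 2 :* (t :* t :* t)))) ≋-refl X T ⟩
    κ 4 ⊠ (X ^ 2 ⊠ T) ⊞ X ⊠ (κ 4 ⊠ X) ⊠ (κ 4 ⊠ (X ^ 2 ⊠ (T ⊠ T ⊠ T))) ∎)
    where
    θT-lin : θ T ≋ κ 4 ⊠ (X ^ 2 ⊠ T) ⊞ X ⊠ (κ 4 ⊠ X) ⊠ θ T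
    θT-lin = ≋-trans θT-eq
      (solve 3 (λ x t u → con 4 :* (x :^ 2 :* (t :+ u)) := con 4 :* (x :^ 2 :* t) :+ x :* (con 4 :* x) :* u) ≋-refl X T (θ T))

  T-rec : ∀ n → (2 + n) * T (2 + n) ≡ 4 * (suc n * T n)
  T-rec n = trans (θT-eq (2 + n)) (trans (κ⊠ 4 _ (2 + n)) (cong (4 *_) (X^⊠-coeff 2 (T ⊞ θ T) n)))

  T³-coeff : ∀ n → (2 + n) * T (2 + n) ≡ 4 * (T ⊠ T ⊠ T) n
  T³-coeff n = trans (θT-closed (2 + n)) (trans (κ⊠ 4 _ (2 + n)) (cong (4 *_) (X^⊠-coeff 2 (T ⊠ T ⊠ T) n)))

  B₂-coeff : ∀ n → B₂ (5 + n) ≡ T (2 + n) + (T ⊠ T ⊠ T) n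
  B₂-coeff n = trans (B₂-closed (5 + n)) (cong₂ _+_ (X^⊠-coeff 3 T (2 + n)) (X^⊠-coeff 5 (T ⊠ T ⊠ T) n))

open Solution using (T; T₀≡1; T-rec; T³-coeff; B₂-coeff)

φ-via-T : ∀ q → 4 * φ (q + 2) ≡ (6 + 2 * q) * T (2 + 2 * q)
φ-via-T q = begin
  4 * φ (q + 2)                                   ≡⟨ cong (4 *_) (φ-diagonal (q + 2)) ⟩
  4 * gP 2 (suc (2 * (q + 2)))                    ≡⟨ cong (λ n → 4 * gP 2 (suc n)) 2[q+2]≡4+2q ⟩
  4 * gP 2 (5 + 2 * q)                            ≡⟨ cong (4 *_) (B₂-coeff (2 * q)) ⟩
  4 * (T (2 + 2 * q) + (T ⊠ T ⊠ T) (2 * q))       ≡⟨ *-distribˡ-+ 4 (T (2 + 2 * q)) _ ⟩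
  4 * T (2 + 2 * q) + 4 * (T ⊠ T ⊠ T) (2 * q)     ≡⟨ cong (4 * T (2 + 2 * q) +_) (sym (T³-coeff (2 * q))) ⟩
  4 * T (2 + 2 * q) + (2 + 2 * q) * T (2 + 2 * q) ≡⟨ sym (*-distribʳ-+ (T (2 + 2 * q)) 4 (2 + 2 * q)) ⟩
  (6 + 2 * q) * T (2 + 2 * q)                     ∎
  where
  open ≡-Reasoning
  open +-*-Solver
  2[q+2]≡4+2q : 2 * (q + 2) ≡ 4 + 2 * q
  2[q+2]≡4+2q = solve 1 (λ q → con 2 :* (q :+ con 2) := con 4 :+ con 2 :* q) refl q

C-absorb : ∀ n k → suc k * (suc n C suc k) ≡ suc n * (n C k)
C-absorb zero zero = refl
C-absorb zero (suc k) = *-zeroʳ (suc (suc k))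
C-absorb (suc n) zero = trans (+-identityʳ _) (trans (nC1≡n (suc (suc n))) (sym (*-identityʳ (suc (suc n)))))
C-absorb (suc n) (suc k) = begin
  (2 + k) * (suc (suc n) C suc (suc k))
    ≡⟨ cong ((2 + k) *_) (sym (nCk+nC[k+1]≡[n+1]C[k+1] (suc n) (suc k))) ⟩
  (2 + k) * (suc n C suc k + suc n C suc (suc k))
    ≡⟨ solve 3 (λ k x y → (con 2 :+ k) :* (x :+ y) := ((con 1 :+ k) :* x :+ x) :+ (con 2 :+ k) :* y) refl k (suc n C suc k) (suc n C suc (suc k)) ⟩
  ((suc k * (suc n C suc k)) + suc n C suc k) + (2 + k) * (suc n C suc (suc k))
    ≡⟨ cong₂ (λ x y → (x + suc n C suc k) + y) (C-absorb n k) (C-absorb n (suc k)) ⟩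
  (suc n * (n C k) + suc n C suc k) + suc n * (n C suc k)
    ≡⟨ solve 4 (λ m x y z → (m :* x :+ y) :+ m :* z := y :+ m :* (x :+ z)) refl (suc n) (n C k) (suc n C suc k) (n C suc k) ⟩
  suc n C suc k + suc n * (n C k + n C suc k)
    ≡⟨ cong (λ z → suc n C suc k + suc n * z) (nCk+nC[k+1]≡[n+1]C[k+1] n k) ⟩
  (2 + n) * (suc n C suc k) ∎
  where
  open ≡-Reasoning
  open +-*-Solver

C-middle : ∀ k → suc (2 * k) C k ≡ suc (2 * k) C suc k
C-middle k = trans (nCk≡nC[n∸k] k≤2k+1) (cong (suc (2 * k) C_) 2k+1∸k≡k+1)
  where
  k≤2k+1 : k ≤ suc (2 * k)
  k≤2k+1 = ≤-trans (m≤m+n k (k + 0)) (n≤1+n _)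
  2k+1∸k≡k+1 : suc (2 * k) ∸ k ≡ suc k
  2k+1∸k≡k+1 = trans (+-∸-assoc 1 (m≤m+n k (k + 0))) (cong suc (trans (cong (_∸ k) (cong (k +_) (+-identityʳ k))) (m+n∸m≡n k k)))

C-odd-rec : ∀ k → (2 + k) * (suc (2 * suc k) C suc k) ≡ 2 * (3 + 2 * k) * (suc (2 * k) C k)
C-odd-rec k = begin
  (2 + k) * (suc (2 * suc k) C suc k)                   ≡⟨ cong ((2 + k) *_) (C-middle (suc k)) ⟩
  (2 + k) * (suc (2 * suc k) C suc (suc k))             ≡⟨ C-absorb (2 * suc k) (suc k) ⟩
  suc (2 * suc k) * (2 * suc k C suc k)                 ≡⟨ cong (λ n → suc n * (n C suc k)) (*-suc 2 k) ⟩
  (3 + 2 * k) * (suc (suc (2 * k)) C suc k)             ≡⟨ cong ((3 + 2 * k) *_) (sym (nCk+nC[k+1]≡[n+1]C[k+1] (suc (2 * k)) k)) ⟩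
  (3 + 2 * k) * (suc (2 * k) C k + suc (2 * k) C suc k) ≡⟨ cong (λ z → (3 + 2 * k) * (suc (2 * k) C k + z)) (sym (C-middle k)) ⟩
  (3 + 2 * k) * (suc (2 * k) C k + suc (2 * k) C k)
    ≡⟨ solve 2 (λ m c → m :* (c :+ c) := con 2 :* m :* c) refl (3 + 2 * k) (suc (2 * k) C k) ⟩
  2 * (3 + 2 * k) * (suc (2 * k) C k)                   ∎
  where
  open ≡-Reasoning
  open +-*-Solver

T-even : ∀ k → T (2 + 2 * k) ≡ 2 * (suc (2 * k) C k)
T-even zero = *-cancelˡ-≡ (T 2) 2 2 (trans (T-rec 0) (cong (λ t → 4 * (t + 0)) T₀≡1))
T-even (suc k) = *-cancelˡ-≡ (T (2 + 2 * suc k)) (2 * c') (2 + 2 * suc k) (begin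
  (2 + 2 * suc k) * T (2 + 2 * suc k)        ≡⟨ cong (λ n → (2 + n) * T (2 + n)) (*-suc 2 k) ⟩
  (2 + (2 + 2 * k)) * T (2 + (2 + 2 * k))    ≡⟨ T-rec (2 + 2 * k) ⟩
  4 * ((3 + 2 * k) * T (2 + 2 * k))          ≡⟨ cong (λ t → 4 * ((3 + 2 * k) * t)) (T-even k) ⟩
  4 * ((3 + 2 * k) * (2 * c))                ≡⟨ solve 2 (λ k c → con 4 :* ((con 3 :+ con 2 :* k) :* (con 2 :* c))
                                                          := con 4 :* (con 2 :* (con 3 :+ con 2 :* k) :* c)) refl k c ⟩
  4 * (2 * (3 + 2 * k) * c)                  ≡⟨ cong (4 *_) (sym (C-odd-rec k)) ⟩
  4 * ((2 + k) * c')                         ≡⟨ solve 2 (λ k d → con 4 :* ((con 2 :+ k) :* d)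
                                                          := (con 2 :+ con 2 :* (con 1 :+ k)) :* (con 2 :* d)) refl k c' ⟩
  (2 + 2 * suc k) * (2 * c')                 ∎)
  where
  open ≡-Reasoning
  open +-*-Solver
  c c' : ℕ
  c = suc (2 * k) C k
  c' = suc (2 * suc k) C suc k

mainTheorem11 : (φ 0 ≡ 0) × (φ 1 ≡ 1) × ((q : ℕ) → φ (q + 2) ≡ (q + 3) * ((2 * q + 1) C q))
mainTheorem11 = refl , refl , φ-closed
  where
  φ-closed : ∀ q → φ (q + 2) ≡ (q + 3) * ((2 * q + 1) C q)
  φ-closed q = *-cancelˡ-≡ (φ (q + 2)) ((q + 3) * c) 4 (begin
    4 * φ (q + 2)                    ≡⟨ φ-via-T q ⟩
    (6 + 2 * q) * T (2 + 2 * q)      ≡⟨ cong ((6 + 2 * q) *_) (T-even q) ⟩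
    (6 + 2 * q) * (2 * (suc (2 * q) C q))
                                     ≡⟨ cong (λ n → (6 + 2 * q) * (2 * (n C q))) (+-comm 1 (2 * q)) ⟩
    (6 + 2 * q) * (2 * c)            ≡⟨ solve 2 (λ q c → (con 6 :+ con 2 :* q) :* (con 2 :* c) := con 4 :* ((q :+ con 3) :* c)) refl q c ⟩
    4 * ((q + 3) * c)                ∎)
    where
    open ≡-Reasoning
    open +-*-Solver
    c : ℕ
    c = (2 * q + 1) C q
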